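{- Let $\sigma\in\Sigma$ with $\sigma(i,n-i)\in\{0,1\}$ for every $n\ge2$ and $1\le i\le n-1$, and let $n\ge b\ge1$. Let $t_{\sigma,n}$ be the unique tree in $\mathcal{T}_n$ with $P_\sigma(t_{\sigma,n})=1$. Then \[ \mathcal{D}_\sigma(n)\le N(t_{\sigma,n},b)+b. \]
   Context: Binary trees are terms over a leaf symbol $a$ and a binary symbol $f$: $a$ is a binary tree, and if $t_1,t_2$ are binary trees then so is $f(t_1,t_2)$. $|t|$ is the number of leaves of $t$, $\mathcal{T}_n$ the set of binary trees with $n$ leaves. For a node $v$ of $t$, its leaf-size is the number of leaves of the subtree rooted at $v$; $N(t,b)$ is the number of nodes of $t$ of leaf-size greater than $b$. $|\mathcal{D}_t|$ (the size of the minimal DAG of $t$) is the number of pairwise non-isomorphic subtrees of $t$. $\Sigma$ is the set of functions $\sigma:(\mathbb{N}\setminus\{0\})^2\to[0,1]$ with $\sum_{i,j\ge1,\, i+j=k}\sigma(i,j)=1$ for every integer $k\ge2$. For $\sigma\in\Sigma$, $P_\sigma(a)=1$ and $P_\sigma(f(u,v))=\sigma(|u|,|v|)P_\sigma(u)P_\sigma(v)$, and $\mathcal{D}_\sigma(n)=\sum_{t\in\mathcal{T}_n}P_\sigma(t)|\mathcal{D}_t|$. -}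

module Defs where

open import Data.Nat as ℕ using (ℕ; zero; suc; _∸_; _<ᵇ_)
open import Data.Bool using (Bool; true; false; if_then_else_)
open import Data.List using (List; []; _∷_; _++_; map; concatMap; filter; length; foldr; upTo; deduplicate)
open import Data.Integer using (+_)
open import Data.Rational using (ℚ; 0ℚ; 1ℚ; _+_; _*_; _/_)
open import Relation.Binary.PropositionalEquality using (_≡_; refl; cong₂)
open import Relation.Binary using (DecidableEquality)
open import Relation.Nullary using (yes; no)
open import Data.Nat.Properties using (_≟_)
import Data.Product
import Data.Rational

data Tree : Set where
  a : Tree
  f : Tree → Tree → Tree

leaves : Tree → ℕ
leaves a       = 1
leaves (f u v) = leaves u ℕ.+ leaves v

f-injˡ : ∀ {u v u' v'} → f u v ≡ f u' v' → u ≡ u'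
f-injˡ refl = refl

f-injʳ : ∀ {u v u' v'} → f u v ≡ f u' v' → v ≡ v'
f-injʳ refl = refl

_≟T_ : DecidableEquality Tree
a ≟T a = yes refl
a ≟T f _ _ = no (λ ())
f _ _ ≟T a = no (λ ())
f u v ≟T f u' v' with u ≟T u' | v ≟T v'
... | yes p | yes q = yes (cong₂ f p q)
... | no ¬p | _     = no (λ e → ¬p (f-injˡ e))
... | yes _ | no ¬q = no (λ e → ¬q (f-injʳ e))

treesDepth : ℕ → List Tree
treesDepth zero    = a ∷ []
treesDepth (suc d) = a ∷ concatMap (λ u → map (f u) (treesDepth d)) (treesDepth d)

-- 𝒯_n : all binary trees with n leaves (such a tree has depth ≤ n - 1 ≤ n)
𝒯 : ℕ → List Tree
𝒯 n = filter (λ t → leaves t ≟ n) (treesDepth n)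

subtrees : Tree → List Tree
subtrees a       = a ∷ []
subtrees (f u v) = f u v ∷ (subtrees u ++ subtrees v)

-- |𝒟_t| : number of pairwise non-isomorphic (= distinct) subtrees of t
dagSize : Tree → ℕ
dagSize t = length (deduplicate _≟T_ (subtrees t))

N : Tree → ℕ → ℕ
N t b = length (filter (λ s → b ℕ.<? leaves s) (subtrees t))

ℕtoℚ : ℕ → ℚ
ℕtoℚ n = + n / 1

sumℚ : List ℚ → ℚ
sumℚ = foldr _+_ 0ℚ

-- σ is given as a function ℕ → ℕ → ℚ; only its values on positive arguments matter.
-- σ ∈ Σ : values in [0,1] on (ℕ∖{0})², and Σ_{i+j=k, i,j≥1} σ(i,j) = 1 for every k ≥ 2.
InΣ : (ℕ → ℕ → ℚ) → Set
InΣ σ =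
  (∀ i j → 1 ℕ.≤ i → 1 ℕ.≤ j → (0ℚ Data.Rational.≤ σ i j) Data.Product.× (σ i j Data.Rational.≤ 1ℚ))
  Data.Product.×
  (∀ k → 2 ℕ.≤ k → sumℚ (map (λ i → σ (suc i) (k ∸ suc i)) (upTo (k ∸ 1))) ≡ 1ℚ)


P : (ℕ → ℕ → ℚ) → Tree → ℚ
P σ a       = 1ℚ
P σ (f u v) = σ (leaves u) (leaves v) * (P σ u * P σ v)

𝒟 : (ℕ → ℕ → ℚ) → ℕ → ℚ
𝒟 σ n = sumℚ (map (λ t → P σ t * ℕtoℚ (dagSize t)) (𝒯 n))

-- Because σ takes only the values 0 and 1, so does P_σ.  A tree t with
-- P_σ(t) = 1 has root split σ(|u|,|v|) = 1, and since the splits of k sum to 1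
-- (σ ∈ Σ) there is at most one such split for each k; by induction, a tree of
-- weight 1 is determined by its number of leaves.  Consequently
--   * the sum 𝒟_σ(n) over the duplicate-free list 𝒯_n has exactly one nonzero
--     term, the one of t_{σ,n}, so 𝒟_σ(n) = |𝒟_t|;
--   * every subtree of t has weight 1, so distinct subtrees of t have distinct
--     leaf counts; the distinct subtrees with more than b leaves are at most
--     N(t,b), and those with at most b leaves have pairwise distinct leaf counts
--     in [1,b], so there are at most b of them.
module Submission where

open import Defs
open import Data.Nat using (ℕ; _≤_; _∸_)
open import Data.Rational using (ℚ; 0ℚ; 1ℚ; _+_)
open import Data.Sum using (_⊎_)
open import Data.List.Membership.Propositional using (_∈_)
open import Relation.Binary.PropositionalEquality using (_≡_)
import Data.Rational

open import Data.Nat as ℕ using (zero; suc; z≤n; s≤s; _<_; _≟_; _<?_)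
import Data.Nat.Properties as ℕP
open import Data.Integer as ℤ using (+_; +≤+)
open import Data.Rational as Q using (mkℚ; _*_; *≤*)
import Data.Rational.Properties as QP
import Data.Integer.Properties as ℤP
import Data.Nat.Coprimality as Coprime
open import Data.Sum using (inj₁; inj₂)
open import Data.Product using (_×_; _,_; proj₁; proj₂)
open import Data.Empty using (⊥-elim)
open import Data.List using (List; []; _∷_; _++_; map; filter; length; upTo; deduplicate; concatMap; cartesianProductWith)
open import Data.List.Properties using (length-map)
open import Data.List.Relation.Unary.All as All using (All; []; _∷_)
import Data.List.Relation.Unary.All.Properties as AllP
open import Data.List.Relation.Unary.AllPairs using (AllPairs; []; _∷_)
import Data.List.Relation.Unary.AllPairs.Properties as AllPairsP
open import Data.List.Relation.Unary.Unique.Propositional using (Unique)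
import Data.List.Relation.Unary.Unique.Propositional.Properties as UniqueP
import Data.List.Relation.Unary.Unique.DecPropositional.Properties as DedupP
open import Data.List.Relation.Unary.Any using (here; there)
open import Data.List.Membership.Propositional.Properties
  using (∈-filter⁻; ∈-upTo⁺; ∈-upTo⁻; ∈-deduplicate⁻; ∈-cartesianProductWith⁻)
open import Data.List.Relation.Binary.Sublist.Propositional using (_⊆_; []; _∷_; ⊆-trans)
import Data.List.Relation.Binary.Sublist.Propositional.Properties as SublistP
open import Relation.Binary using (Rel) renaming (Decidable to Decidable₂)
open import Relation.Binary.PropositionalEquality using (refl; sym; trans; cong; cong₂; subst; subst₂; _≢_)
open import Relation.Nullary using (¬_; yes; no; ¬?)
open import Relation.Unary using (Pred; Decidable)
open import Level using (Level)

private
  variable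
    ℓ : Level
    A : Set ℓ

ℕtoℚ-mkℚ : ∀ n → ℕtoℚ n ≡ mkℚ (+ n) 0 (Coprime.sym (Coprime.1-coprimeTo n))
ℕtoℚ-mkℚ n = QP.normalize-coprime (Coprime.sym (Coprime.1-coprimeTo n))

ℕtoℚ-+ : ∀ m n → ℕtoℚ (m ℕ.+ n) ≡ ℕtoℚ m + ℕtoℚ n
ℕtoℚ-+ m n = trans
  (cong (Q._/ 1) (cong₂ ℤ._+_ (sym (ℤP.*-identityʳ (+ m))) (sym (ℤP.*-identityʳ (+ n)))))
  (cong₂ _+_ (sym (ℕtoℚ-mkℚ m)) (sym (ℕtoℚ-mkℚ n)))

ℕtoℚ-mono-≤ : ∀ {m n} → m ≤ n → ℕtoℚ m Q.≤ ℕtoℚ n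
ℕtoℚ-mono-≤ {m} {n} m≤n rewrite ℕtoℚ-mkℚ m | ℕtoℚ-mkℚ n =
  *≤* (subst₂ ℤ._≤_ (sym (ℤP.*-identityʳ (+ m))) (sym (ℤP.*-identityʳ (+ n))) (+≤+ m≤n))

2ℚ≰1ℚ : ¬ (1ℚ + 1ℚ Q.≤ 1ℚ)
2ℚ≰1ℚ (*≤* (+≤+ (s≤s ())))

Bit : ℚ → Set
Bit x = (x ≡ 0ℚ) ⊎ (x ≡ 1ℚ)

Bit-* : ∀ {x y} → Bit x → Bit y → Bit (x * y)
Bit-* {y = y} (inj₁ refl) _  = inj₁ (QP.*-zeroˡ y)
Bit-* {y = y} (inj₂ refl) by = subst Bit (sym (QP.*-identityˡ y)) by

Bit-*≡1 : ∀ {x y} → Bit x → Bit y → x * y ≡ 1ℚ → (x ≡ 1ℚ) × (y ≡ 1ℚ)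
Bit-*≡1 {y = y} (inj₁ refl) _ xy≡1 with () ← trans (sym (QP.*-zeroˡ y)) xy≡1
Bit-*≡1 (inj₂ refl) (inj₁ refl) xy≡1 with () ← trans (sym (QP.*-zeroʳ 1ℚ)) xy≡1
Bit-*≡1 (inj₂ refl) (inj₂ refl) _ = refl , refl

module _ (g : A → ℚ) where

  Nonneg : List A → Set _
  Nonneg L = ∀ {x} → x ∈ L → 0ℚ Q.≤ g x

  x≤x+y : ∀ {x y} → 0ℚ Q.≤ y → x Q.≤ x + y
  x≤x+y {x} {y} 0≤y = subst (Q._≤ x + y) (QP.+-identityʳ x) (QP.+-monoʳ-≤ x 0≤y)

  y≤x+y : ∀ {x y} → 0ℚ Q.≤ x → y Q.≤ x + y
  y≤x+y {x} {y} 0≤x = subst (Q._≤ x + y) (QP.+-identityˡ y) (QP.+-monoˡ-≤ y 0≤x)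

  sumℚ-nonneg : ∀ L → Nonneg L → 0ℚ Q.≤ sumℚ (map g L)
  sumℚ-nonneg []      _  = QP.≤-refl
  sumℚ-nonneg (x ∷ L) nn = QP.≤-trans (nn (here refl)) (x≤x+y (sumℚ-nonneg L (λ p → nn (there p))))

  sumℚ-≥-term : ∀ {x} L → x ∈ L → Nonneg L → g x Q.≤ sumℚ (map g L)
  sumℚ-≥-term (_ ∷ L) (here refl) nn = x≤x+y (sumℚ-nonneg L (λ p → nn (there p)))
  sumℚ-≥-term (y ∷ L) (there p)   nn =
    QP.≤-trans (sumℚ-≥-term L p (λ q → nn (there q))) (y≤x+y (nn (here refl)))

  sumℚ-≥-pair : ∀ {x y} L → x ≢ y → x ∈ L → y ∈ L → Nonneg L → g x + g y Q.≤ sumℚ (map g L)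
  sumℚ-≥-pair (_ ∷ L) x≢y (here refl) (here refl) _ = ⊥-elim (x≢y refl)
  sumℚ-≥-pair {x} (_ ∷ L) _ (here refl) (there q) nn =
    QP.+-monoʳ-≤ (g x) (sumℚ-≥-term L q (λ r → nn (there r)))
  sumℚ-≥-pair {x} (z ∷ L) _ (there p) (here refl) nn =
    subst (Q._≤ g z + sumℚ (map g L)) (QP.+-comm (g z) (g x))
      (QP.+-monoʳ-≤ (g z) (sumℚ-≥-term L p (λ r → nn (there r))))
  sumℚ-≥-pair (z ∷ L) x≢y (there p) (there q) nn =
    QP.≤-trans (sumℚ-≥-pair L x≢y p q (λ r → nn (there r))) (y≤x+y (nn (here refl)))

  sumℚ-zero : ∀ L → All (λ x → g x ≡ 0ℚ) L → sumℚ (map g L) ≡ 0ℚ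
  sumℚ-zero []      []         = refl
  sumℚ-zero (x ∷ L) (gx ∷ gL) = trans (cong₂ _+_ gx (sumℚ-zero L gL)) (QP.+-identityˡ 0ℚ)

  sumℚ-single : ∀ {t} L → Unique L → t ∈ L → (∀ {x} → x ∈ L → x ≢ t → g x ≡ 0ℚ) →
    sumℚ (map g L) ≡ g t
  sumℚ-single {t} (_ ∷ L) (t∉L ∷ _) (here refl) vanish =
    trans (cong (_+_ (g t)) (sumℚ-zero L (All.tabulate off-t))) (QP.+-identityʳ (g t))
    where
    off-t : ∀ {x} → x ∈ L → g x ≡ 0ℚ
    off-t x∈L = vanish (there x∈L) (λ x≡t → All.lookup t∉L x∈L (sym x≡t))
  sumℚ-single (x ∷ L) (x∉L ∷ uL) (there t∈L) vanish =
    trans (cong₂ _+_ (vanish (here refl) (λ x≡t → All.lookup x∉L t∈L x≡t))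
                     (sumℚ-single L uL t∈L (λ p → vanish (there p))))
          (QP.+-identityˡ _)

length-split : ∀ {P : Pred A ℓ} (P? : Decidable P) L →
  length L ≡ length (filter P? L) ℕ.+ length (filter (λ x → ¬? (P? x)) L)
length-split P? [] = refl
length-split P? (x ∷ L) with P? x
... | yes _ = cong suc (length-split P? L)
... | no  _ = trans (cong suc (length-split P? L)) (sym (ℕP.+-suc _ _))

deduplicate-⊆ : ∀ {R : Rel A ℓ} (R? : Decidable₂ R) L → deduplicate R? L ⊆ L
deduplicate-⊆ R? []      = []
deduplicate-⊆ R? (x ∷ L) = refl ∷ ⊆-trans (SublistP.filter-⊆ _ _) (deduplicate-⊆ R? L)

Unique-map⁺-∈ : ∀ {B : Set ℓ} (h : A → B) {L} →
  (∀ {x y} → x ∈ L → y ∈ L → h x ≡ h y → x ≡ y) → Unique L → Unique (map h L)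
Unique-map⁺-∈ h inj uL = AllPairsP.map⁺ (restrict inj uL)
  where
  restrict : ∀ {L} → (∀ {x y} → x ∈ L → y ∈ L → h x ≡ h y → x ≡ y) → Unique L →
    AllPairs (λ x y → h x ≢ h y) L
  restrict inj′ []            = []
  restrict inj′ (x∉L ∷ uL′) =
    All.tabulate (λ y∈L hx≡hy → All.lookup x∉L y∈L (inj′ (here refl) (there y∈L) hx≡hy))
    ∷ restrict (λ p q → inj′ (there p) (there q)) uL′

InRange : ℕ → ℕ → Set
InRange b x = (1 ≤ x) × (x ≤ b)

pigeonhole : ∀ b (xs : List ℕ) → Unique xs → All (InRange b) xs → length xs ≤ b
pigeonhole zero    []       _ _                 = z≤n
pigeonhole zero    (x ∷ _)  _ ((1≤x , x≤0) ∷ _) = ⊥-elim (ℕP.<-irrefl refl (ℕP.≤-trans 1≤x x≤0))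
pigeonhole (suc b) xs uxs rxs =
  subst (_≤ suc b) (sym (length-split (_≟ suc b) xs))
    (ℕP.+-mono-≤ (at-most-one (filter (_≟ suc b) xs) (UniqueP.filter⁺ _ uxs) (AllP.all-filter _ xs))
                 (pigeonhole b _ (UniqueP.filter⁺ _ uxs) (All.zipWith lower (AllP.filter⁺ _ rxs , AllP.all-filter _ xs))))
  where
  at-most-one : ∀ ys → Unique ys → All (_≡ suc b) ys → length ys ≤ 1
  at-most-one []          _                 _               = z≤n
  at-most-one (_ ∷ [])    _                 _               = s≤s z≤n
  at-most-one (_ ∷ _ ∷ _) ((x≢y ∷ _) ∷ _) (x≡c ∷ y≡c ∷ _) = ⊥-elim (x≢y (trans x≡c (sym y≡c)))
  lower : ∀ {x} → InRange (suc b) x × ¬ x ≡ suc b → InRange b x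
  lower ((1≤x , x≤b+1) , x≢b+1) = 1≤x , ℕ.s≤s⁻¹ (ℕP.≤∧≢⇒< x≤b+1 x≢b+1)

leaves-pos : ∀ t → 1 ≤ leaves t
leaves-pos a       = s≤s z≤n
leaves-pos (f u v) = ℕP.≤-trans (leaves-pos u) (ℕP.m≤m+n (leaves u) (leaves v))

leaves-left< : ∀ u v → leaves u < leaves (f u v)
leaves-left< u v = ℕP.m<m+n (leaves u) (leaves-pos v)

leaves-node>1 : ∀ u v → 1 < leaves (f u v)
leaves-node>1 u v = ℕP.≤-trans (s≤s (leaves-pos u)) (leaves-left< u v)

concatMap≡cartesianProductWith : ∀ {B C : Set} (g : A → B → C) xs ys →
  concatMap (λ x → map (g x) ys) xs ≡ cartesianProductWith g xs ys
concatMap≡cartesianProductWith g []       ys = refl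
concatMap≡cartesianProductWith g (x ∷ xs) ys =
  cong (map (g x) ys ++_) (concatMap≡cartesianProductWith g xs ys)

f-injective : ∀ {u v u′ v′} → f u v ≡ f u′ v′ → (u ≡ u′) × (v ≡ v′)
f-injective refl = refl , refl

treesDepth-unique : ∀ d → Unique (treesDepth d)
treesDepth-unique zero    = [] ∷ []
treesDepth-unique (suc d) rewrite concatMap≡cartesianProductWith f (treesDepth d) (treesDepth d) =
  All.tabulate a∉products ∷ UniqueP.cartesianProductWith⁺ f f-injective (treesDepth-unique d) (treesDepth-unique d)
  where
  a∉products : ∀ {t} → t ∈ cartesianProductWith f (treesDepth d) (treesDepth d) → a ≢ t
  a∉products t∈ a≡t with _ , _ , _ , _ , t≡fuv ← ∈-cartesianProductWith⁻ f (treesDepth d) (treesDepth d) t∈ =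
    a≢f (trans a≡t t≡fuv)
    where
    a≢f : ∀ {u v} → a ≢ f u v
    a≢f ()

𝒯-unique : ∀ n → Unique (𝒯 n)
𝒯-unique n = UniqueP.filter⁺ _ (treesDepth-unique n)

𝒯-leaves : ∀ {n t} → t ∈ 𝒯 n → leaves t ≡ n
𝒯-leaves {n} t∈𝒯 = proj₂ (∈-filter⁻ (λ s → leaves s ≟ n) {xs = treesDepth n} t∈𝒯)

-- The distinct subtrees with more than b leaves are
-- among the N(t,b) nodes of that size; those with at most b leaves have
-- pairwise distinct leaf counts in [1,b].
SizeDetermined : Tree → Set
SizeDetermined t = ∀ {u v} → u ∈ subtrees t → v ∈ subtrees t → leaves u ≡ leaves v → u ≡ v

dagSize-bound : ∀ t b → SizeDetermined t → dagSize t ≤ N t b ℕ.+ b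
dagSize-bound t b sizeDet =
  subst (_≤ N t b ℕ.+ b) (sym (length-split big? D))
    (ℕP.+-mono-≤ big-bound (subst (_≤ b) (length-map leaves small) small-bound))
  where
  big? : Decidable (λ s → b < leaves s)
  big? s = b <? leaves s
  D : List Tree
  D = deduplicate _≟T_ (subtrees t)
  small : List Tree
  small = filter (λ s → ¬? (big? s)) D

  big-bound : length (filter big? D) ≤ N t b
  big-bound = SublistP.length-mono-≤ (SublistP.filter⁺ big? big? (λ { refl p → p }) (deduplicate-⊆ _≟T_ (subtrees t)))

  small⊆subtrees : ∀ {s} → s ∈ small → s ∈ subtrees t
  small⊆subtrees s∈ = ∈-deduplicate⁻ _≟T_ (subtrees t) (proj₁ (∈-filter⁻ _ {xs = D} s∈))

  small-bound : length (map leaves small) ≤ b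
  small-bound = pigeonhole b (map leaves small)
    (Unique-map⁺-∈ leaves (λ p q → sizeDet (small⊆subtrees p) (small⊆subtrees q))
      (UniqueP.filter⁺ _ (DedupP.deduplicate-! _≟T_ (subtrees t))))
    (AllP.map⁺ (All.map (λ {s} s-small → leaves-pos s , ℕP.≮⇒≥ s-small) (AllP.all-filter _ D)))

-- Among the splits (i, k-i) of k, at most one has weight 1, because the
-- weights are nonnegative and sum to 1.
σ-one-split-unique : ∀ (σ : ℕ → ℕ → ℚ) → InΣ σ → ∀ k i j → 1 ≤ i → 1 ≤ j → i < k → j < k →
  σ i (k ∸ i) ≡ 1ℚ → σ j (k ∸ j) ≡ 1ℚ → i ≡ j
σ-one-split-unique σ (bounds , total) (suc k) (suc i) (suc j) _ _ i<k j<k σi≡1 σj≡1 with i ≟ j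
... | yes i≡j = cong suc i≡j
... | no  i≢j = ⊥-elim (2ℚ≰1ℚ (subst₂ Q._≤_ (cong₂ _+_ σi≡1 σj≡1) (total (suc k) (ℕP.≤-trans (s≤s (s≤s z≤n)) i<k))
      (sumℚ-≥-pair split (upTo k) i≢j (∈-upTo⁺ (ℕ.s≤s⁻¹ i<k)) (∈-upTo⁺ (ℕ.s≤s⁻¹ j<k)) split-nonneg)))
  where
  split : ℕ → ℚ
  split m = σ (suc m) (k ∸ m)
  split-nonneg : Nonneg split (upTo k)
  split-nonneg m∈ = proj₁ (bounds _ _ (s≤s z≤n) (ℕP.m<n⇒0<n∸m (∈-upTo⁻ m∈)))

module Deterministic (σ : ℕ → ℕ → ℚ) (σ∈Σ : InΣ σ)
  (σ-bit : ∀ n i → 2 ≤ n → 1 ≤ i → i ≤ n ∸ 1 → (σ i (n ∸ i) ≡ 0ℚ) ⊎ (σ i (n ∸ i) ≡ 1ℚ)) where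

  -- The weight of the root split of f u v, written in the form σ(i, k - i).
  root-split : Tree → Tree → ℚ
  root-split u v = σ (leaves u) (leaves (f u v) ∸ leaves u)

  root-split≡ : ∀ u v → root-split u v ≡ σ (leaves u) (leaves v)
  root-split≡ u v = cong (σ (leaves u)) (ℕP.m+n∸m≡n (leaves u) (leaves v))

  root-bit : ∀ u v → Bit (σ (leaves u) (leaves v))
  root-bit u v = subst Bit (root-split≡ u v)
    (σ-bit (leaves (f u v)) (leaves u) (leaves-node>1 u v) (leaves-pos u)
           (ℕP.<⇒≤pred (leaves-left< u v)))

  P-bit : ∀ t → Bit (P σ t)
  P-bit a       = inj₂ refl
  P-bit (f u v) = Bit-* (root-bit u v) (Bit-* (P-bit u) (P-bit v))

  P-one-split : ∀ u v → P σ (f u v) ≡ 1ℚ → (root-split u v ≡ 1ℚ) × (P σ u ≡ 1ℚ) × (P σ v ≡ 1ℚ)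
  P-one-split u v Puv≡1
    with σ≡1 , Pu*Pv≡1 ← Bit-*≡1 (root-bit u v) (Bit-* (P-bit u) (P-bit v)) Puv≡1
    with Pu≡1 , Pv≡1 ← Bit-*≡1 (P-bit u) (P-bit v) Pu*Pv≡1
    = trans (root-split≡ u v) σ≡1 , Pu≡1 , Pv≡1

  P-one-subtrees : ∀ t → P σ t ≡ 1ℚ → All (λ s → P σ s ≡ 1ℚ) (subtrees t)
  P-one-subtrees a       Pt≡1 = Pt≡1 ∷ []
  P-one-subtrees (f u v) Pt≡1 with _ , Pu≡1 , Pv≡1 ← P-one-split u v Pt≡1 =
    Pt≡1 ∷ AllP.++⁺ (P-one-subtrees u Pu≡1) (P-one-subtrees v Pv≡1)

  P-one-unique : ∀ t₁ t₂ → P σ t₁ ≡ 1ℚ → P σ t₂ ≡ 1ℚ → leaves t₁ ≡ leaves t₂ → t₁ ≡ t₂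
  P-one-unique a a _ _ _ = refl
  P-one-unique a (f u v) _ _ 1≡k = ⊥-elim (ℕP.<-irrefl 1≡k (leaves-node>1 u v))
  P-one-unique (f u v) a _ _ k≡1 = ⊥-elim (ℕP.<-irrefl (sym k≡1) (leaves-node>1 u v))
  P-one-unique (f u₁ v₁) (f u₂ v₂) P₁≡1 P₂≡1 k₁≡k₂
    with σ₁≡1 , Pu₁≡1 , Pv₁≡1 ← P-one-split u₁ v₁ P₁≡1
       | σ₂≡1 , Pu₂≡1 , Pv₂≡1 ← P-one-split u₂ v₂ P₂≡1 =
    cong₂ f (P-one-unique u₁ u₂ Pu₁≡1 Pu₂≡1 lu₁≡lu₂)
            (P-one-unique v₁ v₂ Pv₁≡1 Pv₂≡1 (ℕP.+-cancelˡ-≡ (leaves u₁) _ _ (trans k₁≡k₂ (cong (ℕ._+ leaves v₂) (sym lu₁≡lu₂)))))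
    where
    lu₁≡lu₂ : leaves u₁ ≡ leaves u₂
    lu₁≡lu₂ = σ-one-split-unique σ σ∈Σ (leaves (f u₁ v₁)) (leaves u₁) (leaves u₂) (leaves-pos u₁) (leaves-pos u₂)
      (leaves-left< u₁ v₁) (subst (leaves u₂ <_) (sym k₁≡k₂) (leaves-left< u₂ v₂))
      σ₁≡1 (subst (λ k → σ (leaves u₂) (k ∸ leaves u₂) ≡ 1ℚ) (sym k₁≡k₂) σ₂≡1)

  P-one-sizeDetermined : ∀ t → P σ t ≡ 1ℚ → SizeDetermined t
  P-one-sizeDetermined t Pt≡1 u∈ v∈ =
    P-one-unique _ _ (All.lookup (P-one-subtrees t Pt≡1) u∈) (All.lookup (P-one-subtrees t Pt≡1) v∈)

  𝒟-single : ∀ n t → t ∈ 𝒯 n → P σ t ≡ 1ℚ → 𝒟 σ n ≡ ℕtoℚ (dagSize t)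
  𝒟-single n t t∈𝒯 Pt≡1 =
    trans (sumℚ-single term (𝒯 n) (𝒯-unique n) t∈𝒯 other-terms-vanish)
          (trans (cong (_* ℕtoℚ (dagSize t)) Pt≡1) (QP.*-identityˡ (ℕtoℚ (dagSize t))))
    where
    term : Tree → ℚ
    term s = P σ s * ℕtoℚ (dagSize s)
    other-terms-vanish : ∀ {s} → s ∈ 𝒯 n → s ≢ t → term s ≡ 0ℚ
    other-terms-vanish {s} s∈𝒯 s≢t with P-bit s
    ... | inj₁ Ps≡0 = trans (cong (_* ℕtoℚ (dagSize s)) Ps≡0) (QP.*-zeroˡ (ℕtoℚ (dagSize s)))
    ... | inj₂ Ps≡1 = ⊥-elim (s≢t (P-one-unique s t Ps≡1 Pt≡1 (trans (𝒯-leaves {n} s∈𝒯) (sym (𝒯-leaves {n} t∈𝒯)))))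

lemma3p20 : (σ : ℕ → ℕ → ℚ) → InΣ σ →
    (∀ n i → 2 ≤ n → 1 ≤ i → i ≤ n ∸ 1 → (σ i (n ∸ i) ≡ 0ℚ) ⊎ (σ i (n ∸ i) ≡ 1ℚ)) →
    (n b : ℕ) → 1 ≤ b → b ≤ n →
    (t : Tree) → t ∈ 𝒯 n → P σ t ≡ 1ℚ →
    𝒟 σ n Data.Rational.≤ ℕtoℚ (N t b) + ℕtoℚ b
lemma3p20 σ σ∈Σ σ-bit n b _ _ t t∈𝒯 Pt≡1 = begin
  𝒟 σ n                    ≡⟨ 𝒟-single n t t∈𝒯 Pt≡1 ⟩
  ℕtoℚ (dagSize t)         ≤⟨ ℕtoℚ-mono-≤ (dagSize-bound t b (P-one-sizeDetermined t Pt≡1)) ⟩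
  ℕtoℚ (N t b ℕ.+ b)       ≡⟨ ℕtoℚ-+ (N t b) b ⟩
  ℕtoℚ (N t b) + ℕtoℚ b    ∎
  where
  open Deterministic σ σ∈Σ σ-bit
  open QP.≤-Reasoning
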